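{- The lower density threshold of 2-Visits is at least $\sqrt{2}-1/2\approx 0.9142$ and at most $1$. That is, every 2-Visits instance $D$ with $\mathrm{Dens}(D)\leq\sqrt{2}-1/2$ admits a schedule, and the lower density threshold (the largest $\delta$ such that all instances of density at most $\delta$ admit a schedule) does not exceed $1$.
   Context: 2-Visits: given a multiset of positive integers (deadlines) $D=\{d_1,\ldots,d_n\}$, decide whether there is a sequence of length $2n$ containing each $i\in[n]$ exactly twice, with the first occurrence of $i$ within the first $d_i$ positions and the second at most $d_i$ positions after the first. The density of $D$ is $\mathrm{Dens}(D)=\sum_{i=1}^n 1/d_i$. The lower density threshold of a problem is the largest value $\delta$ such that every instance with density at most $\delta$ admits a schedule. -}

module Defs where

open import Data.Nat using (ℕ; zero; suc)
import Data.Nat as ℕ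
open import Data.Fin using (Fin; toℕ)
import Data.Fin as F
open import Data.Integer using (+_)
open import Data.Rational using (ℚ; 0ℚ; _/_; _+_)
open import Data.Product using (Σ; _×_; ∃)
open import Data.Sum using (_⊎_)
open import Relation.Binary.PropositionalEquality using (_≡_)

Positive : {n : ℕ} → (Fin n → ℕ) → Set
Positive {n} D = (i : Fin n) → 1 ℕ.≤ D i

-- 1/d as a rational (value at d = 0 is irrelevant: deadlines are positive)
inv : ℕ → ℚ
inv zero = 0ℚ
inv (suc k) = + 1 / suc k

Dens : {n : ℕ} → (Fin n → ℕ) → ℚ
Dens {zero} D = 0ℚ
Dens {suc n} D = inv (D F.zero) + Dens {n} (λ i → D (F.suc i))

-- A schedule: a sequence s of length 2n (positions 0-indexed) in which each
-- job i occurs exactly twice, at positions p < q, with the first occurrence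
-- among the first d_i positions (toℕ p + 1 ≤ d_i) and the second at most d_i
-- positions after the first (toℕ q ≤ toℕ p + d_i).
ValidFor : {n : ℕ} → (Fin n → ℕ) → (Fin (2 ℕ.* n) → Fin n) → Fin n → Set
ValidFor {n} D s i =
  Σ (Fin (2 ℕ.* n)) λ p → Σ (Fin (2 ℕ.* n)) λ q →
    (toℕ p ℕ.< toℕ q) × (s p ≡ i) × (s q ≡ i) ×
    ((r : Fin (2 ℕ.* n)) → s r ≡ i → (r ≡ p) ⊎ (r ≡ q)) ×
    (toℕ p ℕ.< D i) × (toℕ q ℕ.≤ toℕ p ℕ.+ D i)

Schedulable : {n : ℕ} → (Fin n → ℕ) → Set
Schedulable {n} D = Σ (Fin (2 ℕ.* n) → Fin n) λ s → (i : Fin n) → ValidFor D s i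

-- Sort the deadlines, d₀ ≤ … ≤ d_{n-1}, and let p be the first job with n ≤ p + d_p.  Call P
-- roomy if P + i < d_i for every job i ≥ P.  If some P ≥ p is roomy, schedule the first P jobs
-- recursively in positions [0, 2P) and append the jobs P + u, u < k = n - P, twice in a row, at
-- 2P + u and 2P + u + k: the first visit is on time by roominess, and the gap k ≤ d_p ≤ d_{P+u}
-- by the choice of p.  Otherwise every P ≥ p is crowded, witnessed by some i ≥ P with
-- d_i ≤ P + i.  Following these witnesses, the jobs p, …, n - 1 have density at least m/(2p + m),
-- where m = n - p, and the jobs before p have deadlines at most m, adding p/m.  With
-- y = p/m + 1/2 the density plus 1/2 is at least y + 1/(2y) ≥ √2, with equality excluded since
-- √2 is irrational; so (Dens + 1/2)² ≤ 2 always leaves room for a schedule.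
--
-- For the upper bound, one job with deadline 2m and m jobs with deadline m would need 2m + 1
-- visits among the first 2m positions, and taking m to be the denominator of δ > 1 makes the
-- density 1 + 1/(2m) at most δ.

module Submission where

module TwoVisits where

  open import Defs

  open import Data.Nat as ℕ
    using (ℕ; zero; suc; _+_; _*_; _∸_; _≤_; _<_; _≤?_; _<?_; z≤n; s≤s; NonZero)
  import Data.Nat.Properties as ℕ
  open import Data.Nat.Induction using (<-wellFounded)
  open import Data.Nat.DivMod using (_%_; m%n<n; m<n⇒m%n≡m; [m+n]%n≡m%n)
  open import Data.Nat.Tactic.RingSolver using (solve-∀; solve)
  open import Data.List.Base using ([]; _∷_)
  open import Data.Integer as ℤ using (+≤+)
  import Data.Integer.Properties as ℤ
  open import Data.Rational.Unnormalised as ℚᵘ using (ℚᵘ; mkℚᵘ; 0ℚᵘ; *≤*; *≡*)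
  import Data.Rational.Unnormalised.Properties as ℚᵘ
  open import Data.Fin as Fin using (Fin; toℕ; fromℕ<)
  import Data.Fin.Properties as Fin
  open import Data.Fin.Permutation as Perm using (Permutation′; _⟨$⟩ʳ_; _⟨$⟩ˡ_; lift₀; transpose; _∘ₚ_)
  open import Data.Rational as ℚ using (ℚ; mkℚ)
  import Data.Rational.Properties as ℚ
  open import Algebra.Properties.CommutativeMonoid.Sum ℚ.+-0-commutativeMonoid using (sum; sum-permute)
  open import Data.Product using (Σ; ∃; ∃₂; _×_; _,_; proj₁; proj₂)
  open import Data.Sum using (_⊎_; inj₁; inj₂; [_,_]′; reduce)
  import Data.Sum as Sum
  open import Data.Empty using (⊥-elim)
  open import Function using (_∘_; id)
  open import Induction.WellFounded using (Acc; acc)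
  open import Relation.Nullary using (¬_; Dec; yes; no)
  open import Relation.Nullary.Decidable using (_×-dec_)
  open import Relation.Binary.PropositionalEquality
    using (_≡_; _≢_; refl; sym; trans; cong; cong₂; subst; subst₂; module ≡-Reasoning)

  infixl 7 _÷_

  _÷_ : ℕ → (b : ℕ) → .{{NonZero b}} → ℚᵘ
  a ÷ b = ℤ.+ a ℚᵘ./ b

  -- a ÷ suc b is definitionally mkℚᵘ (+ a) b, hence the successor denominators below.
  *≤*⇒÷≤÷ : ∀ {a b c e} → a * suc e ≤ c * suc b → a ÷ suc b ℚᵘ.≤ c ÷ suc e
  *≤*⇒÷≤÷ {a} {b} {c} {e} le = *≤* (subst₂ ℤ._≤_ (ℤ.pos-* a (suc e)) (ℤ.pos-* c (suc b)) (+≤+ le))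

  ÷≤÷⇒*≤* : ∀ {a b c e} → a ÷ suc b ℚᵘ.≤ c ÷ suc e → a * suc e ≤ c * suc b
  ÷≤÷⇒*≤* {a} {b} {c} {e} (*≤* le) =
    ℤ.drop‿+≤+ (subst₂ ℤ._≤_ (sym (ℤ.pos-* a (suc e))) (sym (ℤ.pos-* c (suc b))) le)

  *≡*⇒÷≃÷ : ∀ {a b c e} → a * suc e ≡ c * suc b → a ÷ suc b ℚᵘ.≃ c ÷ suc e
  *≡*⇒÷≃÷ {a} {b} {c} {e} eq = *≡* (trans (sym (ℤ.pos-* a (suc e))) (trans (cong ℤ.+_ eq) (ℤ.pos-* c (suc b))))

  ÷+÷ : ∀ a b c e → a ÷ suc b ℚᵘ.+ c ÷ suc e ≡ (a * suc e + c * suc b) ÷ (suc b * suc e)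
  ÷+÷ a b c e = cong (λ z → mkℚᵘ z (e + b * suc e))
    (trans (cong₂ ℤ._+_ (sym (ℤ.pos-* a (suc e))) (sym (ℤ.pos-* c (suc b)))) (sym (ℤ.pos-+ (a * suc e) (c * suc b))))

  ÷*÷ : ∀ a b c e → (a ÷ suc b) ℚᵘ.* (c ÷ suc e) ≡ (a * c) ÷ (suc b * suc e)
  ÷*÷ a b c e = cong (λ z → mkℚᵘ z (e + b * suc e)) (sym (ℤ.pos-* a c))

  ÷≤-square : ∀ {a b c e y} → a ÷ suc b ℚᵘ.≤ y → y ℚᵘ.* y ℚᵘ.≤ c ÷ suc e → a * a * suc e ≤ c * (suc b * suc b)
  ÷≤-square {a} {b} {c} {e} a÷b≤y y²≤c÷e =
    ÷≤÷⇒*≤* (subst (ℚᵘ._≤ c ÷ suc e) (÷*÷ a b a b) (ℚᵘ.≤-trans (ℚᵘ.*-mono-≤-nonNeg a÷b≤y a÷b≤y) y²≤c÷e))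

  invᵘ : ℕ → ℚᵘ
  invᵘ zero = 0ℚᵘ
  invᵘ (suc k) = 1 ÷ suc k

  density : (ℕ → ℕ) → ℕ → ℚᵘ
  density d zero = 0ℚᵘ
  density d (suc k) = invᵘ (d 0) ℚᵘ.+ density (d ∘ suc) k

  invᵘ-antitone : ∀ {x y} → 1 ≤ x → x ≤ y → invᵘ y ℚᵘ.≤ invᵘ x
  invᵘ-antitone {suc x} {suc y} _ x≤y = *≤*⇒÷≤÷ (ℕ.+-monoˡ-≤ 0 x≤y)

  density-antitone : ∀ {d e} k → (∀ {i} → i < k → 1 ≤ d i) → (∀ {i} → i < k → d i ≤ e i) →
                     density e k ℚᵘ.≤ density d k
  density-antitone zero _ _ = ℚᵘ.≤-refl
  density-antitone (suc k) pos d≤e = ℚᵘ.+-mono-≤ (invᵘ-antitone (pos (s≤s z≤n)) (d≤e (s≤s z≤n)))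
    (density-antitone k (pos ∘ s≤s) (d≤e ∘ s≤s))

  density-cong : ∀ {d e} k → (∀ {i} → i < k → d i ≡ e i) → density d k ≡ density e k
  density-cong zero _ = refl
  density-cong (suc k) d≡e = cong₂ ℚᵘ._+_ (cong invᵘ (d≡e (s≤s z≤n))) (density-cong k (d≡e ∘ s≤s))

  density-nonNegative : ∀ d k → 0ℚᵘ ℚᵘ.≤ density d k
  density-nonNegative d zero = ℚᵘ.≤-refl
  density-nonNegative d (suc k) = ℚᵘ.+-mono-≤ (invᵘ-nonNegative (d 0)) (density-nonNegative (d ∘ suc) k)
    where
    invᵘ-nonNegative : ∀ x → 0ℚᵘ ℚᵘ.≤ invᵘ x
    invᵘ-nonNegative zero = ℚᵘ.≤-refl
    invᵘ-nonNegative (suc x) = *≤*⇒÷≤÷ z≤n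

  density-+ : ∀ d k l → density d (k + l) ℚᵘ.≃ density d k ℚᵘ.+ density (d ∘ (k +_)) l
  density-+ d zero l = ℚᵘ.≃-sym (ℚᵘ.+-identityˡ (density d l))
  density-+ d (suc k) l = ℚᵘ.≃-trans (ℚᵘ.+-congʳ (invᵘ (d 0)) (density-+ (d ∘ suc) k l))
    (ℚᵘ.≃-sym (ℚᵘ.+-assoc (invᵘ (d 0)) (density (d ∘ suc) k) (density (d ∘ (suc k +_)) l)))

  density-prefix : ∀ d k l → density d k ℚᵘ.≤ density d (k + l)
  density-prefix d k l = ℚᵘ.≤-respʳ-≃ (ℚᵘ.≃-sym (density-+ d k l))
    (ℚᵘ.≤-respˡ-≃ (ℚᵘ.+-identityʳ (density d k)) (ℚᵘ.+-monoʳ-≤ (density d k) (density-nonNegative _ l)))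

  density-const : ∀ c k → density (λ _ → suc c) k ℚᵘ.≃ k ÷ suc c
  density-const c zero = *≡*⇒÷≃÷ refl
  density-const c (suc k) = ℚᵘ.≃-trans (ℚᵘ.+-congʳ (1 ÷ suc c) (density-const c k))
    (ℚᵘ.≃-trans (ℚᵘ.≃-reflexive (÷+÷ 1 c k c)) (*≡*⇒÷≃÷ (identity c k)))
    where
    identity : ∀ c k → (1 * suc c + k * suc c) * suc c ≡ suc k * (suc c * suc c)
    identity = solve-∀

  ÷≤density : ∀ {d} k c → (∀ {i} → i < k → 1 ≤ d i) → (∀ {i} → i < k → d i ≤ suc c) →
              k ÷ suc c ℚᵘ.≤ density d k
  ÷≤density k c pos bounded = ℚᵘ.≤-respˡ-≃ (density-const c k) (density-antitone k pos bounded)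

  -- The density bound p/m + m/(2p + m)

  even⊎odd : ∀ a → ∃ λ c → a ≡ 2 * c ⊎ a ≡ suc (2 * c)
  even⊎odd zero = 0 , inj₁ refl
  even⊎odd (suc a) with even⊎odd a
  ... | c , inj₁ refl = c , inj₂ refl
  ... | c , inj₂ refl = suc c , inj₁ (cong suc (sym (ℕ.+-suc c (c + 0))))

  even-square-halves : ∀ {a b} → a * a ≡ 2 * (b * b) → ∃ λ c → a ≡ 2 * c × b * b ≡ 2 * (c * c)
  even-square-halves {a} {b} eq with even⊎odd a
  ... | c , inj₁ refl = c , refl , ℕ.*-cancelˡ-≡ (b * b) (2 * (c * c)) 2 (begin
    2 * (b * b)       ≡⟨ sym eq ⟩
    2 * c * (2 * c)   ≡⟨ solve (c ∷ []) ⟩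
    2 * (2 * (c * c)) ∎)
    where open ≡-Reasoning
  ... | c , inj₂ refl = ⊥-elim (ℕ.even≢odd (b * b) (2 * (c * c) + 2 * c) (begin
    2 * (b * b)                       ≡⟨ sym eq ⟩
    suc (2 * c) * suc (2 * c)         ≡⟨ solve (c ∷ []) ⟩
    suc (2 * (2 * (c * c) + 2 * c))   ∎))
    where open ≡-Reasoning

  √2-irrational : ∀ {a b} → a * a ≡ 2 * (b * b) → b ≡ 0
  √2-irrational {a} {b} = descend {a} (<-wellFounded b)
    where
    half< : ∀ {b g} → suc b ≡ 2 * g → g < suc b
    half< {g = suc g} eq = subst (suc g <_) (sym eq) (ℕ.m<m+n (suc g) (s≤s z≤n))
    descend : ∀ {a b} → Acc _<_ b → a * a ≡ 2 * (b * b) → b ≡ 0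
    descend {a} {zero} _ _ = refl
    descend {a} {b@(suc _)} (acc smaller) eq
      with c , _ , b²≡2c² ← even-square-halves {a} {b} eq
      with g , b≡2g , c²≡2g² ← even-square-halves {b} {c} b²≡2c²
      = trans b≡2g (cong (2 *_) (descend {c} {g} (smaller (half< b≡2g)) c²≡2g²))

  [x+y]²≤4xy⇒x≡y : ∀ x y → (x + y) * (x + y) ≤ 4 * (x * y) → x ≡ y
  [x+y]²≤4xy⇒x≡y x y le = [ (λ x≤y → ordered x≤y le) , (λ y≤x → sym (ordered y≤x (subst₂ _≤_ (swap x y) (swap′ x y) le))) ]′ (ℕ.≤-total x y)
    where
    swap : ∀ x y → (x + y) * (x + y) ≡ (y + x) * (y + x)
    swap = solve-∀
    swap′ : ∀ x y → 4 * (x * y) ≡ 4 * (y * x)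
    swap′ = solve-∀
    ordered : ∀ {x y} → x ≤ y → (x + y) * (x + y) ≤ 4 * (x * y) → x ≡ y
    ordered {x} x≤y le with t , refl ← ℕ.m≤n⇒∃[o]m+o≡n x≤y = sym (trans (cong (x +_) t≡0) (ℕ.+-identityʳ x))
      where
      expand : (x + (x + t)) * (x + (x + t)) ≡ 4 * (x * (x + t)) + t * t
      expand = solve (x ∷ t ∷ [])
      t≡0 : t ≡ 0
      t≡0 = reduce (ℕ.m*n≡0⇒m≡0∨n≡0 t (ℕ.n≤0⇒n≡0 (ℕ.+-cancelˡ-≤ (4 * (x * (x + t))) (t * t) 0
              (subst₂ _≤_ expand (sym (ℕ.+-identityʳ _)) le))))

  [a²+2b²]²≤2[2ab]²⇒b≡0 : ∀ a b → (a * a + 2 * (b * b)) * (a * a + 2 * (b * b)) ≤ 2 * ((2 * (a * b)) * (2 * (a * b))) → b ≡ 0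
  [a²+2b²]²≤2[2ab]²⇒b≡0 a b le = √2-irrational {a} {b} ([x+y]²≤4xy⇒x≡y (a * a) (2 * (b * b)) (ℕ.≤-trans le (ℕ.≤-reflexive (identity a b))))
    where
    identity : ∀ a b → 2 * ((2 * (a * b)) * (2 * (a * b))) ≡ 4 * (a * a * (2 * (b * b)))
    identity = solve-∀

  chainBound : ℕ → ℕ → ℚᵘ
  chainBound a zero = 0ℚᵘ
  chainBound a (suc k) = suc k ÷ suc (a + a + k)

  chainBound-subadditive : ∀ a b c → chainBound a (b + c) ℚᵘ.≤ chainBound a b ℚᵘ.+ chainBound (a + b) c
  chainBound-subadditive a zero c rewrite ℕ.+-identityʳ a = ℚᵘ.≤-reflexive (ℚᵘ.≃-sym (ℚᵘ.+-identityˡ _))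
  chainBound-subadditive a (suc j) zero rewrite ℕ.+-identityʳ j = ℚᵘ.≤-reflexive (ℚᵘ.≃-sym (ℚᵘ.+-identityʳ _))
  chainBound-subadditive a (suc j) (suc l) =
    ℚᵘ.≤-respʳ-≃ (ℚᵘ.≃-reflexive (sym (÷+÷ (suc j) (a + a + j) (suc l) (a + suc j + (a + suc j) + l))))
      (*≤*⇒÷≤÷ (ℕ.≤-trans (ℕ.m≤m+n _ (suc j * suc l * (suc j + suc l))) (ℕ.≤-reflexive (sym (identity a j l)))))
    where
    identity : ∀ a j l →
      (suc j * suc (a + suc j + (a + suc j) + l) + suc l * suc (a + a + j)) * suc (a + a + (j + suc l))
      ≡ suc (j + suc l) * (suc (a + a + j) * suc (a + suc j + (a + suc j) + l)) + suc j * suc l * (suc j + suc l)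
    identity = solve-∀

  obstruction : (p m : ℕ) → .{{NonZero m}} → ℚᵘ
  obstruction p m = p ÷ m ℚᵘ.+ chainBound p m

  -- This is (a² + 2b²)/(2ab) for b = m + 1 and a = 2p + b; its square is 2 + ((a² - 2b²)/(2ab))².
  obstruction+½ : ∀ p m → let a = suc (p + p + m); b = suc m in
                  obstruction p (suc m) ℚᵘ.+ ℚᵘ.½ ℚᵘ.≃ (a * a + 2 * (b * b)) ÷ (2 * (a * b))
  obstruction+½ p m = begin
    (p ÷ b ℚᵘ.+ b ÷ a) ℚᵘ.+ 1 ÷ 2                 ≡⟨ cong (ℚᵘ._+ 1 ÷ 2) (÷+÷ p m b (p + p + m)) ⟩
    (p * a + b * b) ÷ (b * a) ℚᵘ.+ 1 ÷ 2          ≡⟨ ÷+÷ (p * a + b * b) (p + p + m + m * a) 1 1 ⟩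
    ((p * a + b * b) * 2 + 1 * (b * a)) ÷ (b * a * 2)  ≈⟨ *≡*⇒÷≃÷ (identity p m) ⟩
    (a * a + 2 * (b * b)) ÷ (2 * (a * b))         ∎
    where
    open ℚᵘ.≃-Reasoning
    a = suc (p + p + m)
    b = suc m
    identity : ∀ p m → let a = suc (p + p + m); b = suc m in
      ((p * a + b * b) * 2 + 1 * (b * a)) * (2 * (a * b)) ≡ (a * a + 2 * (b * b)) * (b * a * 2)
    identity = solve-∀

  obstruction-exceeds : ∀ p m {x} → obstruction p (suc m) ℚᵘ.≤ x →
                        ¬ ((x ℚᵘ.+ ℚᵘ.½) ℚᵘ.* (x ℚᵘ.+ ℚᵘ.½) ℚᵘ.≤ 2 ÷ 1)
  obstruction-exceeds p m {x} obstruction≤x square≤2 = ℕ.1+n≢0 b≡0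
    where
    a = suc (p + p + m)
    b = suc m
    q = (a * a + 2 * (b * b)) ÷ (2 * (a * b))
    q≤x+½ : q ℚᵘ.≤ x ℚᵘ.+ ℚᵘ.½
    q≤x+½ = ℚᵘ.≤-respˡ-≃ (obstruction+½ p m) (ℚᵘ.+-monoˡ-≤ ℚᵘ.½ obstruction≤x)
    b≡0 : b ≡ 0
    b≡0 = [a²+2b²]²≤2[2ab]²⇒b≡0 a b
      (subst (_≤ 2 * ((2 * (a * b)) * (2 * (a * b)))) (ℕ.*-identityʳ _) (÷≤-square q≤x+½ square≤2))

  m<n+n⇒m≡m%n⊎m≡m%n+n : ∀ {m n} .{{_ : NonZero n}} → m < n + n → m ≡ m % n ⊎ m ≡ m % n + n
  m<n+n⇒m≡m%n⊎m≡m%n+n {m} {n} m<2n with m <? n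
  ... | yes m<n = inj₁ (sym (m<n⇒m%n≡m m<n))
  ... | no m≮n = inj₂ (begin
    m               ≡⟨ sym (ℕ.m∸n+n≡m n≤m) ⟩
    m ∸ n + n       ≡⟨ cong (_+ n) (sym (m<n⇒m%n≡m m∸n<n)) ⟩
    (m ∸ n) % n + n ≡⟨ cong (_+ n) (sym ([m+n]%n≡m%n (m ∸ n) n)) ⟩
    (m ∸ n + n) % n + n ≡⟨ cong (λ x → x % n + n) (ℕ.m∸n+n≡m n≤m) ⟩
    m % n + n       ∎)
    where
    open ≡-Reasoning
    n≤m = ℕ.≮⇒≥ m≮n
    m∸n<n : m ∸ n < n
    m∸n<n = ℕ.+-cancelʳ-< n (m ∸ n) n (subst (_< n + n) (sym (ℕ.m∸n+n≡m n≤m)) m<2n)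

  record Visits (d : ℕ → ℕ) (n : ℕ) (job : ℕ → ℕ) (i : ℕ) : Set where
    field
      first second : ℕ
      first<second : first < second
      second<2n : second < n + n
      job-first : job first ≡ i
      job-second : job second ≡ i
      only : ∀ {r} → r < n + n → job r ≡ i → r ≡ first ⊎ r ≡ second
      first<deadline : first < d i
      second≤first+deadline : second ≤ first + d i

  record Schedule (d : ℕ → ℕ) (n : ℕ) : Set where
    field
      job : ℕ → ℕ
      job<n : ∀ {r} → r < n + n → job r < n
      visits : ∀ {i} → i < n → Visits d n job i

  emptySchedule : ∀ {d} → Schedule d 0
  emptySchedule = record { job = λ _ → 0 ; job<n = λ () ; visits = λ () }

  below⊎above : ∀ m r → r < m ⊎ ∃ λ v → r ≡ m + v
  below⊎above m r with r <? m
  ... | yes r<m = inj₁ r<m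
  ... | no r≮m = inj₂ (r ∸ m , sym (ℕ.m+[n∸m]≡n (ℕ.≮⇒≥ r≮m)))

  module _ {d : ℕ → ℕ} {P : ℕ} (S : Schedule d P) (k : ℕ) .{{_ : NonZero k}} where
    open Schedule S

    -- Position 2P + v holds job P + v mod k, so job P + u is visited at 2P + u and 2P + u + k.
    appendedJob : ℕ → ℕ
    appendedJob r with below⊎above (P + P) r
    ... | inj₁ _ = job r
    ... | inj₂ (v , _) = P + v % k

    appendedJob-old : ∀ {r} → r < P + P → appendedJob r ≡ job r
    appendedJob-old {r} r<2P with below⊎above (P + P) r
    ... | inj₁ _ = refl
    ... | inj₂ (v , refl) = ⊥-elim (ℕ.m+n≮m (P + P) v r<2P)

    appendedJob-new : ∀ v → appendedJob (P + P + v) ≡ P + v % k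
    appendedJob-new v with below⊎above (P + P) (P + P + v)
    ... | inj₁ r<2P = ⊥-elim (ℕ.m+n≮m (P + P) v r<2P)
    ... | inj₂ (w , eq) = cong (λ x → P + x % k) (sym (ℕ.+-cancelˡ-≡ (P + P) v w eq))

    appendedJob<P+k : ∀ {r} → r < (P + k) + (P + k) → appendedJob r < P + k
    appendedJob<P+k {r} _ with below⊎above (P + P) r
    ... | inj₁ r<2P = ℕ.<-≤-trans (job<n r<2P) (ℕ.m≤m+n P k)
    ... | inj₂ (v , refl) = ℕ.+-monoʳ-< P (m%n<n v k)

    appendedVisits-old : ∀ {i} → i < P → Visits d (P + k) appendedJob i
    appendedVisits-old {i} i<P = record
      { first = first
      ; second = second
      ; first<second = first<second
      ; second<2n = ℕ.<-≤-trans second<2n (ℕ.+-mono-≤ (ℕ.m≤m+n P k) (ℕ.m≤m+n P k))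
      ; job-first = trans (appendedJob-old (ℕ.<-trans first<second second<2n)) job-first
      ; job-second = trans (appendedJob-old second<2n) job-second
      ; only = only′
      ; first<deadline = first<deadline
      ; second≤first+deadline = second≤first+deadline
      }
      where
      open Visits (visits i<P)
      only′ : ∀ {r} → r < (P + k) + (P + k) → appendedJob r ≡ i → r ≡ first ⊎ r ≡ second
      only′ {r} _ eq with below⊎above (P + P) r
      ... | inj₁ r<2P = only r<2P eq
      ... | inj₂ (v , refl) = ⊥-elim (ℕ.<⇒≱ i<P (subst (P ≤_) eq (ℕ.m≤m+n P _)))

    appendedVisits-new : ∀ {u} → u < k → k ≤ d (P + u) → P + (P + u) < d (P + u) →
                         Visits d (P + k) appendedJob (P + u)
    appendedVisits-new {u} u<k k≤d P+i<d = record
      { first = P + P + u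
      ; second = P + P + (u + k)
      ; first<second = ℕ.+-monoʳ-< (P + P) (ℕ.m<m+n u (ℕ.>-nonZero⁻¹ k))
      ; second<2n = subst (P + P + (u + k) <_) (sym 4-terms) (ℕ.+-monoʳ-< (P + P) (ℕ.+-monoˡ-< k u<k))
      ; job-first = trans (appendedJob-new u) (cong (P +_) (m<n⇒m%n≡m u<k))
      ; job-second = trans (appendedJob-new (u + k)) (cong (P +_) (trans ([m+n]%n≡m%n u k) (m<n⇒m%n≡m u<k)))
      ; only = only′
      ; first<deadline = subst (_< d (P + u)) (sym (ℕ.+-assoc P P u)) P+i<d
      ; second≤first+deadline = subst (_≤ P + P + u + d (P + u)) (ℕ.+-assoc (P + P) u k) (ℕ.+-monoʳ-≤ (P + P + u) k≤d)
      }
      where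
      4-terms : (P + k) + (P + k) ≡ P + P + (k + k)
      4-terms = solve (P ∷ k ∷ [])
      only′ : ∀ {r} → r < (P + k) + (P + k) → appendedJob r ≡ P + u → r ≡ P + P + u ⊎ r ≡ P + P + (u + k)
      only′ {r} r<2n eq with below⊎above (P + P) r
      ... | inj₁ r<2P = ⊥-elim (ℕ.<⇒≱ (job<n r<2P) (subst (P ≤_) (sym eq) (ℕ.m≤m+n P u)))
      ... | inj₂ (v , refl) = Sum.map (λ v≡v%k → cong (P + P +_) (trans v≡v%k v%k≡u))
                                      (λ v≡v%k+k → cong (P + P +_) (trans v≡v%k+k (cong (_+ k) v%k≡u)))
                                      (m<n+n⇒m≡m%n⊎m≡m%n+n v<2k)
        where
        v%k≡u : v % k ≡ u
        v%k≡u = ℕ.+-cancelˡ-≡ P (v % k) u eq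
        v<2k : v < k + k
        v<2k = ℕ.+-cancelˡ-< (P + P) v (k + k) (subst (P + P + v <_) 4-terms r<2n)

    appendBlock : (∀ {i} → P ≤ i → i < P + k → k ≤ d i) → (∀ {i} → P ≤ i → i < P + k → P + i < d i) →
                  Schedule d (P + k)
    appendBlock k≤d P+i<d = record { job = appendedJob ; job<n = appendedJob<P+k ; visits = appendedVisits }
      where
      appendedVisits : ∀ {i} → i < P + k → Visits d (P + k) appendedJob i
      appendedVisits {i} i<P+k with below⊎above P i
      ... | inj₁ i<P = appendedVisits-old i<P
      ... | inj₂ (u , refl) = appendedVisits-new u<k (k≤d P≤P+u i<P+k) (P+i<d P≤P+u i<P+k)
        where
        u<k = ℕ.+-cancelˡ-< P u k i<P+k
        P≤P+u = ℕ.m≤m+n P u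

  -- The scheduling algorithm

  some⊎all : ∀ {A B : ℕ → Set} → (∀ x → A x ⊎ B x) → ∀ n → (∃ λ x → x < n × A x) ⊎ (∀ {x} → x < n → B x)
  some⊎all A⊎B zero = inj₂ λ ()
  some⊎all A⊎B (suc n) with some⊎all A⊎B n | A⊎B n
  ... | inj₁ (x , x<n , Ax) | _ = inj₁ (x , ℕ.m<n⇒m<1+n x<n , Ax)
  ... | inj₂ _ | inj₁ An = inj₁ (n , ℕ.≤-refl , An)
  ... | inj₂ allB | inj₂ Bn = inj₂ λ x<1+n → [ allB , (λ { refl → Bn }) ]′ (ℕ.m<1+n⇒m<n∨m≡n x<1+n)

  least⊎none : ∀ {A : ℕ → Set} → (∀ x → Dec (A x)) → ∀ n →
               (∃ λ x → x < n × A x × (∀ {y} → y < x → ¬ A y)) ⊎ (∀ {x} → x < n → ¬ A x)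
  least⊎none A? zero = inj₂ λ ()
  least⊎none A? (suc n) with least⊎none A? n
  ... | inj₁ (x , x<n , Ax , below) = inj₁ (x , ℕ.m<n⇒m<1+n x<n , Ax , below)
  ... | inj₂ none with A? n
  ...   | yes An = inj₁ (n , ℕ.≤-refl , An , none)
  ...   | no ¬An = inj₂ λ x<1+n → [ none , (λ { refl → ¬An }) ]′ (ℕ.m<1+n⇒m<n∨m≡n x<1+n)

  PositiveBelow : ℕ → (ℕ → ℕ) → Set
  PositiveBelow n d = ∀ {i} → i < n → 1 ≤ d i

  SortedBelow : ℕ → (ℕ → ℕ) → Set
  SortedBelow n d = ∀ {i j} → i ≤ j → j < n → d i ≤ d j

  Roomy : (ℕ → ℕ) → ℕ → ℕ → Set
  Roomy d n P = ∀ {i} → P ≤ i → i < n → P + i < d i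

  Crowded : (ℕ → ℕ) → ℕ → ℕ → Set
  Crowded d n P = ∃ λ i → P ≤ i × i < n × d i ≤ P + i

  roomy⊎crowded : ∀ d n P → Roomy d n P ⊎ Crowded d n P
  roomy⊎crowded d n P with ℕ.anyUpTo? (λ i → P ≤? i ×-dec d i ≤? P + i) n
  ... | yes (i , i<n , P≤i , dᵢ≤P+i) = inj₂ (i , P≤i , i<n , dᵢ≤P+i)
  ... | no none = inj₁ λ P≤i i<n → ℕ.≰⇒> λ dᵢ≤P+i → none (_ , i<n , P≤i , dᵢ≤P+i)

  roomy⊎crowded-from : ∀ d n p P → (p ≤ P × Roomy d n P) ⊎ (p ≤ P → Crowded d n P)
  roomy⊎crowded-from d n p P with p ≤? P
  ... | no p≰P = inj₂ λ p≤P → ⊥-elim (p≰P p≤P)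
  ... | yes p≤P with roomy⊎crowded d n P
  ...   | inj₁ roomy = inj₁ (p≤P , roomy)
  ...   | inj₂ crowded = inj₂ λ _ → crowded

  Obstructed : (ℕ → ℕ) → ℕ → Set
  Obstructed d n = ∃₂ λ p m → obstruction p (suc m) ℚᵘ.≤ density d n

  obstructed-mono : ∀ {d k n} → k ≤ n → Obstructed d k → Obstructed d n
  obstructed-mono {d} {k} {n} k≤n (p , m , ob) =
    p , m , ℚᵘ.≤-trans ob (subst (λ x → density d k ℚᵘ.≤ density d x) (ℕ.m+[n∸m]≡n k≤n) (density-prefix d k (n ∸ k)))

  firstReaching : ∀ {d n} → PositiveBelow (suc n) d →
                  ∃₂ λ p m → p + suc m ≡ suc n × suc n ≤ p + d p × (∀ {j} → j < p → j + d j < suc n)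
  firstReaching {d} {n} positive with least⊎none (λ p → suc n ≤? p + d p) (suc n)
  ... | inj₁ (p , p<n , n≤p+dₚ , early) =
    p , n ∸ p , trans (ℕ.+-suc p (n ∸ p)) (cong suc (ℕ.m+[n∸m]≡n (ℕ.s≤s⁻¹ p<n))) , n≤p+dₚ , ℕ.≰⇒> ∘ early
  ... | inj₂ none = ⊥-elim (none ℕ.≤-refl (subst (_≤ n + d n) (ℕ.+-comm n 1) (ℕ.+-monoʳ-≤ n (positive ℕ.≤-refl))))

  positive-prefix : ∀ {d n P} → P ≤ n → PositiveBelow n d → PositiveBelow P d
  positive-prefix P≤n positive i<P = positive (ℕ.<-≤-trans i<P P≤n)

  sorted-prefix : ∀ {d n P} → P ≤ n → SortedBelow n d → SortedBelow P d
  sorted-prefix P≤n sorted i≤j j<P = sorted i≤j (ℕ.<-≤-trans j<P P≤n)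

  module _ {d : ℕ → ℕ} {n : ℕ} (sorted : SortedBelow n d) where

    early-deadlines : ∀ {p m} → p + suc m ≡ n → (∀ {j} → j < p → j + d j < n) → ∀ {j} → j < p → d j ≤ suc m
    early-deadlines {suc p} {m} p+m≡n early (s≤s j≤p) = ℕ.≤-trans (sorted j≤p p<n) dₚ≤1+m
      where
      p<n : p < n
      p<n = subst (p <_) p+m≡n (ℕ.m≤m+n (suc p) (suc m))
      dₚ≤1+m : d p ≤ suc m
      dₚ≤1+m = ℕ.+-cancelˡ-≤ p (d p) (suc m) (ℕ.s≤s⁻¹ (subst (suc (p + d p) ≤_) (sym p+m≡n) (early ℕ.≤-refl)))

    appendRoomyBlock : ∀ {p P} → n ≤ p + d p → p ≤ P → P < n → Roomy d n P → Schedule d P → Schedule d n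
    appendRoomyBlock {p} {P} n≤p+dₚ p≤P P<n roomy S =
      subst (Schedule d) P+k≡n (appendBlock S k k≤d (λ {i} P≤i i<P+k → roomy P≤i (subst (i <_) P+k≡n i<P+k)))
      where
      k = n ∸ P
      instance
        k-nonZero : NonZero k
        k-nonZero = ℕ.>-nonZero (ℕ.m<n⇒0<n∸m P<n)
      P+k≡n : P + k ≡ n
      P+k≡n = ℕ.m+[n∸m]≡n (ℕ.<⇒≤ P<n)
      k≤d : ∀ {i} → P ≤ i → i < P + k → k ≤ d i
      k≤d {i} P≤i i<P+k = ℕ.≤-trans (ℕ.m≤n+o⇒m∸n≤o n P (ℕ.≤-trans n≤p+dₚ (ℕ.+-mono-≤ p≤P (sorted p≤P P<n))))
                                    (sorted P≤i (subst (i <_) P+k≡n i<P+k))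

    module _ (positive : PositiveBelow n d) where

      window-density : ∀ {a j} → a + j < n → d (a + j) ≤ a + (a + j) →
                       chainBound a (suc j) ℚᵘ.≤ density (d ∘ (a +_)) (suc j)
      window-density {a} {j} a+j<n last≤ = ÷≤density (suc j) (a + a + j)
        (λ t≤j → positive (ℕ.≤-<-trans (ℕ.+-monoʳ-≤ a (ℕ.s≤s⁻¹ t≤j)) a+j<n))
        (λ t≤j → ℕ.≤-trans (sorted (ℕ.+-monoʳ-≤ a (ℕ.s≤s⁻¹ t≤j)) a+j<n)
                   (ℕ.≤-trans last≤ (ℕ.≤-trans (ℕ.≤-reflexive (sym (ℕ.+-assoc a a j))) (ℕ.n≤1+n _))))

      crowded-density : ∀ a k → a + k ≡ n → (∀ {P} → a ≤ P → P < n → Crowded d n P) → Acc _<_ k →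
                        chainBound a k ℚᵘ.≤ density (d ∘ (a +_)) k
      crowded-density a zero _ _ _ = ℚᵘ.≤-refl
      crowded-density a (suc k) a+k≡n crowded (acc smaller)
        with i , a≤i , i<n , dᵢ≤a+i ← crowded ℕ.≤-refl (subst (a <_) a+k≡n (ℕ.m<m+n a (s≤s z≤n)))
        with j , refl ← ℕ.m≤n⇒∃[o]m+o≡n a≤i
        with l , refl ← ℕ.m≤n⇒∃[o]m+o≡n (ℕ.+-cancelˡ-< a j (suc k) (subst (a + j <_) (sym a+k≡n) i<n))
        = begin
        chainBound a (suc j + l)                                              ≤⟨ chainBound-subadditive a (suc j) l ⟩
        chainBound a (suc j) ℚᵘ.+ chainBound (a + suc j) l                    ≤⟨ ℚᵘ.+-mono-≤ (window-density i<n dᵢ≤a+i) rest ⟩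
        density (d ∘ (a +_)) (suc j) ℚᵘ.+ density (d ∘ (a + suc j +_)) l     ≡⟨ cong (density (d ∘ (a +_)) (suc j) ℚᵘ.+_) shift ⟩
        density (d ∘ (a +_)) (suc j) ℚᵘ.+ density (d ∘ (a +_) ∘ (suc j +_)) l ≃⟨ ℚᵘ.≃-sym (density-+ (d ∘ (a +_)) (suc j) l) ⟩
        density (d ∘ (a +_)) (suc j + l)                                      ∎
        where
        open ℚᵘ.≤-Reasoning
        shift : density (d ∘ (a + suc j +_)) l ≡ density (d ∘ (a +_) ∘ (suc j +_)) l
        shift = density-cong l λ {t} _ → cong d (ℕ.+-assoc a (suc j) t)
        rest : chainBound (a + suc j) l ℚᵘ.≤ density (d ∘ (a + suc j +_)) l
        rest = crowded-density (a + suc j) l (trans (ℕ.+-assoc a (suc j) l) a+k≡n)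
          (λ a+j<P → crowded (ℕ.≤-trans (ℕ.m≤m+n a (suc j)) a+j<P)) (smaller (s≤s (ℕ.m≤n+m l j)))

      crowded-obstruction : ∀ {p m} → p + suc m ≡ n → (∀ {j} → j < p → j + d j < n) →
                            (∀ {P} → p ≤ P → P < n → Crowded d n P) → obstruction p (suc m) ℚᵘ.≤ density d n
      crowded-obstruction {p} {m} p+m≡n early crowded = begin
        p ÷ suc m ℚᵘ.+ chainBound p (suc m)            ≤⟨ ℚᵘ.+-mono-≤ head tail ⟩
        density d p ℚᵘ.+ density (d ∘ (p +_)) (suc m)  ≃⟨ ℚᵘ.≃-sym (density-+ d p (suc m)) ⟩
        density d (p + suc m)                          ≡⟨ cong (density d) p+m≡n ⟩
        density d n                                    ∎
        where
        open ℚᵘ.≤-Reasoning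
        head : p ÷ suc m ℚᵘ.≤ density d p
        head = ÷≤density p m (λ j<p → positive (ℕ.<-≤-trans j<p (subst (p ≤_) p+m≡n (ℕ.m≤m+n p (suc m)))))
          (early-deadlines p+m≡n early)
        tail : chainBound p (suc m) ℚᵘ.≤ density (d ∘ (p +_)) (suc m)
        tail = crowded-density p (suc m) p+m≡n crowded (<-wellFounded (suc m))

  schedule⊎obstructed : ∀ {d n} → Acc _<_ n → PositiveBelow n d → SortedBelow n d → Schedule d n ⊎ Obstructed d n
  schedule⊎obstructed {n = zero} _ _ _ = inj₁ emptySchedule
  schedule⊎obstructed {d} {n@(suc _)} (acc smaller) positive sorted
    with p , m , p+m≡n , n≤p+dₚ , early ← firstReaching positive
    with some⊎all (roomy⊎crowded-from d n p) n
  ... | inj₂ crowded = inj₂ (p , m , crowded-obstruction sorted positive p+m≡n early λ p≤P P<n → crowded P<n p≤P)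
  ... | inj₁ (P , P<n , p≤P , roomy) =
    Sum.map (appendRoomyBlock sorted n≤p+dₚ p≤P P<n roomy) (obstructed-mono (ℕ.<⇒≤ P<n))
      (schedule⊎obstructed (smaller P<n) (positive-prefix (ℕ.<⇒≤ P<n) positive) (sorted-prefix (ℕ.<⇒≤ P<n) sorted))

  Sorted : ∀ {n} → (Fin n → ℕ) → Set
  Sorted D = ∀ {i j} → i Fin.≤ j → D i ≤ D j

  argmin : ∀ {n} (D : Fin (suc n) → ℕ) → ∃ λ k → ∀ i → D k ≤ D i
  argmin {zero} D = Fin.zero , λ { Fin.zero → ℕ.≤-refl }
  argmin {suc n} D with argmin (D ∘ Fin.suc)
  ... | k , min with D Fin.zero ≤? D (Fin.suc k)
  ...   | yes D₀≤ = Fin.zero , λ { Fin.zero → ℕ.≤-refl ; (Fin.suc i) → ℕ.≤-trans D₀≤ (min i) }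
  ...   | no D₀≰ = Fin.suc k , λ { Fin.zero → ℕ.<⇒≤ (ℕ.≰⇒> D₀≰) ; (Fin.suc i) → min i }

  sort : ∀ {n} (D : Fin n → ℕ) → ∃ λ (σ : Permutation′ n) → Sorted (D ∘ (σ ⟨$⟩ʳ_))
  sort {zero} D = Perm.id , λ {i} → ⊥-elim (Fin.¬Fin0 i)
  sort {suc n} D with argmin D
  ... | k , min with sort (D ∘ (transpose Fin.zero k ⟨$⟩ʳ_) ∘ Fin.suc)
  ...   | σ , sorted = lift₀ σ ∘ₚ transpose Fin.zero k , sorted′
    where
    sorted′ : Sorted (D ∘ ((lift₀ σ ∘ₚ transpose Fin.zero k) ⟨$⟩ʳ_))
    sorted′ {Fin.zero} _ = min _
    sorted′ {Fin.suc i} {Fin.suc j} (s≤s i≤j) = sorted i≤j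

  Dens≡sum : ∀ {n} (D : Fin n → ℕ) → Dens D ≡ sum (inv ∘ D)
  Dens≡sum {zero} D = refl
  Dens≡sum {suc n} D = cong (inv (D Fin.zero) ℚ.+_) (Dens≡sum (D ∘ Fin.suc))

  Dens-permute : ∀ {n} (D : Fin n → ℕ) (σ : Permutation′ n) → Dens (D ∘ (σ ⟨$⟩ʳ_)) ≡ Dens D
  Dens-permute D σ = trans (Dens≡sum (D ∘ (σ ⟨$⟩ʳ_))) (trans (sym (sum-permute (inv ∘ D) σ)) (sym (Dens≡sum D)))

  schedulable-permute : ∀ {n} (D : Fin n → ℕ) (σ : Permutation′ n) → Schedulable (D ∘ (σ ⟨$⟩ʳ_)) → Schedulable D
  schedulable-permute D σ (s , valid) = (σ ⟨$⟩ʳ_) ∘ s , λ i → relabel i (valid (σ ⟨$⟩ˡ i))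
    where
    relabel : ∀ i → ValidFor (D ∘ (σ ⟨$⟩ʳ_)) s (σ ⟨$⟩ˡ i) → ValidFor D ((σ ⟨$⟩ʳ_) ∘ s) i
    relabel i (p , q , p<q , sp , sq , only , p<d , q≤p+d) =
      p , q , p<q , σ-back sp , σ-back sq ,
      (λ r eq → only r (trans (sym (Perm.inverseˡ σ)) (cong (σ ⟨$⟩ˡ_) eq))) ,
      subst (λ j → toℕ p < D j) (Perm.inverseʳ σ) p<d ,
      subst (λ j → toℕ q ≤ toℕ p + D j) (Perm.inverseʳ σ) q≤p+d
      where
      σ-back : ∀ {r} → s r ≡ σ ⟨$⟩ˡ i → σ ⟨$⟩ʳ s r ≡ i
      σ-back eq = trans (cong (σ ⟨$⟩ʳ_) eq) (Perm.inverseʳ σ)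

  -- Indices from n on get the junk deadline 0; every use is restricted to indices below n.
  atℕ : ∀ {n} → (Fin n → ℕ) → ℕ → ℕ
  atℕ {zero} D i = 0
  atℕ {suc n} D zero = D Fin.zero
  atℕ {suc n} D (suc i) = atℕ (D ∘ Fin.suc) i

  atℕ-toℕ : ∀ {n} (D : Fin n → ℕ) i → atℕ D (toℕ i) ≡ D i
  atℕ-toℕ {suc n} D Fin.zero = refl
  atℕ-toℕ {suc n} D (Fin.suc i) = atℕ-toℕ (D ∘ Fin.suc) i

  atℕ-fromℕ< : ∀ {n} (D : Fin n → ℕ) {i} (i<n : i < n) → atℕ D i ≡ D (fromℕ< i<n)
  atℕ-fromℕ< D i<n = trans (cong (atℕ D) (sym (Fin.toℕ-fromℕ< i<n))) (atℕ-toℕ D (fromℕ< i<n))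

  atℕ-positive : ∀ {n} {D : Fin n → ℕ} → Positive D → PositiveBelow n (atℕ D)
  atℕ-positive {D = D} positive i<n = subst (1 ≤_) (sym (atℕ-fromℕ< D i<n)) (positive _)

  atℕ-sorted : ∀ {n} {D : Fin n → ℕ} → Sorted D → SortedBelow n (atℕ D)
  atℕ-sorted {D = D} sorted {i} {j} i≤j j<n = subst₂ _≤_ (sym (atℕ-fromℕ< D i<n)) (sym (atℕ-fromℕ< D j<n))
    (sorted (subst₂ _≤_ (sym (Fin.toℕ-fromℕ< i<n)) (sym (Fin.toℕ-fromℕ< j<n)) i≤j))
    where
    i<n = ℕ.≤-<-trans i≤j j<n

  toℚᵘ-inv : ∀ x → ℚ.toℚᵘ (inv x) ℚᵘ.≃ invᵘ x
  toℚᵘ-inv zero = ℚᵘ.≃-refl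
  toℚᵘ-inv (suc x) = ℚ.toℚᵘ-fromℚᵘ (1 ÷ suc x)

  toℚᵘ-Dens : ∀ {n} (D : Fin n → ℕ) → ℚ.toℚᵘ (Dens D) ℚᵘ.≃ density (atℕ D) n
  toℚᵘ-Dens {zero} D = ℚᵘ.≃-refl
  toℚᵘ-Dens {suc n} D = ℚᵘ.≃-trans (ℚ.toℚᵘ-homo-+ (inv (D Fin.zero)) (Dens (D ∘ Fin.suc)))
    (ℚᵘ.+-cong (toℚᵘ-inv (D Fin.zero)) (toℚᵘ-Dens (D ∘ Fin.suc)))

  schedule⇒schedulable : ∀ {n} (D : Fin n → ℕ) → Schedule (atℕ D) n → Schedulable D
  schedule⇒schedulable {n} D S = jobᶠ , valid
    where
    open Schedule S
    2n≡n+n : 2 * n ≡ n + n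
    2n≡n+n = cong (n +_) (ℕ.+-identityʳ n)
    position : ∀ {r} → r < n + n → Fin (2 * n)
    position {r} r<2n = fromℕ< (subst (r <_) (sym 2n≡n+n) r<2n)
    toℕ-position : ∀ {r} (r<2n : r < n + n) → toℕ (position r<2n) ≡ r
    toℕ-position r<2n = Fin.toℕ-fromℕ< _
    toℕ<2n : ∀ (r : Fin (2 * n)) → toℕ r < n + n
    toℕ<2n r = subst (toℕ r <_) 2n≡n+n (Fin.toℕ<n r)
    jobᶠ : Fin (2 * n) → Fin n
    jobᶠ r = fromℕ< (job<n (toℕ<2n r))
    jobᶠ≡ : ∀ {r i} → job (toℕ r) ≡ toℕ i → jobᶠ r ≡ i
    jobᶠ≡ {r} eq = Fin.toℕ-injective (trans (Fin.toℕ-fromℕ< (job<n (toℕ<2n r))) eq)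
    valid : ∀ i → ValidFor D jobᶠ i
    valid i = position first<2n , position second<2n ,
      subst₂ _<_ (sym (toℕ-position first<2n)) (sym (toℕ-position second<2n)) first<second ,
      jobᶠ≡ {position first<2n} (trans (cong job (toℕ-position first<2n)) job-first) ,
      jobᶠ≡ {position second<2n} (trans (cong job (toℕ-position second<2n)) job-second) ,
      only′ ,
      subst₂ _<_ (sym (toℕ-position first<2n)) (atℕ-toℕ D i) first<deadline ,
      subst₂ _≤_ (sym (toℕ-position second<2n)) (cong₂ _+_ (sym (toℕ-position first<2n)) (atℕ-toℕ D i))
        second≤first+deadline
      where
      open Visits (visits (Fin.toℕ<n i))
      first<2n = ℕ.<-trans first<second second<2n
      only′ : ∀ r → jobᶠ r ≡ i → r ≡ position first<2n ⊎ r ≡ position second<2n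
      only′ r eq = Sum.map (at first<2n) (at second<2n) (only (toℕ<2n r) (trans (sym (Fin.toℕ-fromℕ< (job<n (toℕ<2n r)))) (cong toℕ eq)))
        where
        at : ∀ {x} (x<2n : x < n + n) → toℕ r ≡ x → r ≡ position x<2n
        at x<2n eq = Fin.toℕ-injective (trans eq (sym (toℕ-position x<2n)))

  toℚᵘ-square≤2 : ∀ q → (q ℚ.+ ℚ.½) ℚ.* (q ℚ.+ ℚ.½) ℚ.≤ ℤ.+ 2 ℚ./ 1 →
                  (ℚ.toℚᵘ q ℚᵘ.+ ℚᵘ.½) ℚᵘ.* (ℚ.toℚᵘ q ℚᵘ.+ ℚᵘ.½) ℚᵘ.≤ 2 ÷ 1
  toℚᵘ-square≤2 q square≤2 = ℚᵘ.≤-respˡ-≃ toℚᵘ-square (ℚᵘ.≤-respʳ-≃ (ℚ.toℚᵘ-fromℚᵘ (2 ÷ 1)) (ℚ.toℚᵘ-mono-≤ square≤2))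
    where
    toℚᵘ-+½ : ℚ.toℚᵘ (q ℚ.+ ℚ.½) ℚᵘ.≃ ℚ.toℚᵘ q ℚᵘ.+ ℚᵘ.½
    toℚᵘ-+½ = ℚᵘ.≃-trans (ℚ.toℚᵘ-homo-+ q ℚ.½) (ℚᵘ.+-congʳ (ℚ.toℚᵘ q) (ℚ.toℚᵘ-fromℚᵘ ℚᵘ.½))
    toℚᵘ-square : ℚ.toℚᵘ ((q ℚ.+ ℚ.½) ℚ.* (q ℚ.+ ℚ.½)) ℚᵘ.≃ (ℚ.toℚᵘ q ℚᵘ.+ ℚᵘ.½) ℚᵘ.* (ℚ.toℚᵘ q ℚᵘ.+ ℚᵘ.½)
    toℚᵘ-square = ℚᵘ.≃-trans (ℚ.toℚᵘ-homo-* (q ℚ.+ ℚ.½) (q ℚ.+ ℚ.½)) (ℚᵘ.*-cong toℚᵘ-+½ toℚᵘ-+½)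

  lower-threshold : (n : ℕ) (D : Fin n → ℕ) → Positive D →
                    (Dens D ℚ.+ ℚ.½) ℚ.* (Dens D ℚ.+ ℚ.½) ℚ.≤ ℤ.+ 2 ℚ./ 1 → Schedulable D
  lower-threshold n D positive square≤2
    with σ , sorted ← sort D
    with schedule⊎obstructed (<-wellFounded n) (atℕ-positive (positive ∘ (σ ⟨$⟩ʳ_))) (atℕ-sorted sorted)
  ... | inj₁ S = schedulable-permute D σ (schedule⇒schedulable (D ∘ (σ ⟨$⟩ʳ_)) S)
  ... | inj₂ (p , m , obstruction≤density) = ⊥-elim (obstruction-exceeds p m obstruction≤Dens (toℚᵘ-square≤2 (Dens D) square≤2))
    where
    obstruction≤Dens : obstruction p (suc m) ℚᵘ.≤ ℚ.toℚᵘ (Dens D)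
    obstruction≤Dens = ℚᵘ.≤-respʳ-≃ (ℚᵘ.≃-trans (ℚᵘ.≃-sym (toℚᵘ-Dens (D ∘ (σ ⟨$⟩ʳ_)))) (ℚ.toℚᵘ-cong (Dens-permute D σ)))
      obstruction≤density

  -- An unschedulable family of density close to 1

  module _ {n} {D : Fin n → ℕ} (S : Schedulable D) where
    private
      job = proj₁ S
      valid = proj₂ S

    firstVisit secondVisit : Fin n → Fin (2 * n)
    firstVisit i = proj₁ (valid i)
    secondVisit i = proj₁ (proj₂ (valid i))

    visit : Fin n ⊎ Fin n → Fin (2 * n)
    visit = [ firstVisit , secondVisit ]′

    job-visit : ∀ v → job (visit v) ≡ reduce v
    job-visit (inj₁ i) with _ , _ , _ , job-first , _ ← valid i = job-first
    job-visit (inj₂ i) with _ , _ , _ , _ , job-second , _ ← valid i = job-second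

    firstVisit≢secondVisit : ∀ i → firstVisit i ≢ secondVisit i
    firstVisit≢secondVisit i eq with _ , _ , first<second , _ ← valid i = ℕ.<-irrefl (cong toℕ eq) first<second

    same-job : ∀ u v → visit u ≡ visit v → reduce u ≡ reduce v
    same-job u v eq = trans (sym (job-visit u)) (trans (cong job eq) (job-visit v))

    visit-injective : ∀ {u v} → visit u ≡ visit v → u ≡ v
    visit-injective {inj₁ i} {inj₁ j} eq = cong inj₁ (same-job (inj₁ i) (inj₁ j) eq)
    visit-injective {inj₂ i} {inj₂ j} eq = cong inj₂ (same-job (inj₂ i) (inj₂ j) eq)
    visit-injective {inj₁ i} {inj₂ j} eq with refl ← same-job (inj₁ i) (inj₂ j) eq = ⊥-elim (firstVisit≢secondVisit i eq)
    visit-injective {inj₂ i} {inj₁ j} eq with refl ← same-job (inj₂ i) (inj₁ j) eq = ⊥-elim (firstVisit≢secondVisit i (sym eq))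

    firstVisit<deadline : ∀ i → toℕ (firstVisit i) < D i
    firstVisit<deadline i with _ , _ , _ , _ , _ , _ , first<deadline , _ ← valid i = first<deadline

    secondVisit≤firstVisit+deadline : ∀ i → toℕ (secondVisit i) ≤ toℕ (firstVisit i) + D i
    secondVisit≤firstVisit+deadline i with _ , _ , _ , _ , _ , _ , _ , second≤ ← valid i = second≤

  tightInstance : ∀ c → Fin (suc (suc c)) → ℕ
  tightInstance c Fin.zero = suc c + suc c
  tightInstance c (Fin.suc _) = suc c

  tightInstance-positive : ∀ c → Positive (tightInstance c)
  tightInstance-positive c Fin.zero = s≤s z≤n
  tightInstance-positive c (Fin.suc _) = s≤s z≤n

  tightInstance-unschedulable : ∀ c → ¬ Schedulable (tightInstance c)
  tightInstance-unschedulable c S = ℕ.n≮n (m + m) (Fin.injective⇒≤ position-injective)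
    where
    m = suc c
    n = suc m
    -- The first visits of all jobs and the second visits of the jobs of deadline m lie in [0, 2m).
    earlyVisit : Fin (n + m) → Fin n ⊎ Fin n
    earlyVisit = Sum.map id Fin.suc ∘ Fin.splitAt n
    earlyVisit-injective : ∀ {x y} → earlyVisit x ≡ earlyVisit y → x ≡ y
    earlyVisit-injective {x} {y} eq = begin
      x                              ≡⟨ sym (Fin.join-splitAt n m x) ⟩
      Fin.join n m (Fin.splitAt n x) ≡⟨ cong (Fin.join n m) (unmap (Fin.splitAt n x) (Fin.splitAt n y) eq) ⟩
      Fin.join n m (Fin.splitAt n y) ≡⟨ Fin.join-splitAt n m y ⟩
      y                              ∎
      where
      open ≡-Reasoning
      unmap : ∀ u v → Sum.map id Fin.suc u ≡ Sum.map id Fin.suc v → u ≡ v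
      unmap (inj₁ _) (inj₁ _) refl = refl
      unmap (inj₂ _) (inj₂ _) refl = refl
    early : ∀ v → toℕ (visit S (earlyVisit v)) < m + m
    early v with Fin.splitAt n v
    ... | inj₁ Fin.zero = firstVisit<deadline S Fin.zero
    ... | inj₁ (Fin.suc i) = ℕ.<-≤-trans (firstVisit<deadline S (Fin.suc i)) (ℕ.m≤m+n m m)
    ... | inj₂ i = ℕ.≤-<-trans (secondVisit≤firstVisit+deadline S (Fin.suc i))
                              (ℕ.+-monoˡ-< m (firstVisit<deadline S (Fin.suc i)))
    position : Fin (n + m) → Fin (m + m)
    position v = fromℕ< (early v)
    position-injective : ∀ {x y} → position x ≡ position y → x ≡ y
    position-injective {x} {y} eq = earlyVisit-injective (visit-injective S (Fin.toℕ-injective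
      (trans (sym (Fin.toℕ-fromℕ< (early x))) (trans (cong toℕ eq) (Fin.toℕ-fromℕ< (early y))))))

  tightInstance-density : ∀ c → ℚ.toℚᵘ (Dens (tightInstance c)) ℚᵘ.≃ 1 ÷ suc (c + suc c) ℚᵘ.+ suc c ÷ suc c
  tightInstance-density c = ℚᵘ.≃-trans (toℚᵘ-Dens (tightInstance c)) (ℚᵘ.+-congʳ (1 ÷ suc (c + suc c))
    (ℚᵘ.≃-trans (ℚᵘ.≃-reflexive (density-cong (suc c) (atℕ-fromℕ< (λ _ → suc c)))) (density-const c (suc c))))

  tightInstance-density≤ : ∀ c P → suc c < P → 1 ÷ suc (c + suc c) ℚᵘ.+ suc c ÷ suc c ℚᵘ.≤ P ÷ suc c
  tightInstance-density≤ c P m<P with t , refl ← ℕ.m≤n⇒∃[o]m+o≡n m<P =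
    ℚᵘ.≤-respˡ-≃ (ℚᵘ.≃-reflexive (sym (÷+÷ 1 (c + suc c) (suc c) c)))
      (*≤*⇒÷≤÷ (ℕ.≤-trans (ℕ.m≤m+n _ (suc c * suc c + 2 * t * suc c * suc c)) (ℕ.≤-reflexive (sym (identity c t)))))
    where
    identity : ∀ c t → (suc (suc c) + t) * (suc (c + suc c) * suc c)
                       ≡ (1 * suc c + suc c * suc (c + suc c)) * suc c + (suc c * suc c + 2 * t * suc c * suc c)
    identity = solve-∀

  -- δ = P/(c + 1) in lowest terms with P > c + 1, so δ ≥ 1 + 1/(c + 1) ≥ Dens (tightInstance c).
  upper-threshold : (δ : ℚ) → ℚ.1ℚ ℚ.< δ →
                    Σ ℕ λ n → Σ (Fin n → ℕ) λ D → Positive D × (Dens D ℚ.≤ δ) × ¬ Schedulable D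
  upper-threshold δ@(mkℚ (ℤ.+ P) c _) (ℚ.*<* 1<δ) =
    suc (suc c) , tightInstance c , tightInstance-positive c , Dens≤δ , tightInstance-unschedulable c
    where
    m<P : suc c < P
    m<P = subst₂ _<_ (ℕ.+-identityʳ (suc c)) (ℕ.*-identityʳ P)
      (ℤ.drop‿+<+ (subst₂ ℤ._<_ (sym (ℤ.pos-* 1 (suc c))) (sym (ℤ.pos-* P 1)) 1<δ))
    Dens≤δ : Dens (tightInstance c) ℚ.≤ δ
    Dens≤δ = ℚ.toℚᵘ-cancel-≤ (ℚᵘ.≤-respˡ-≃ (ℚᵘ.≃-sym (tightInstance-density c)) (tightInstance-density≤ c P m<P))
  upper-threshold (mkℚ ℤ.-[1+ _ ] _ _) (ℚ.*<* ())

open import Defs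
open import Data.Nat using (ℕ)
open import Data.Fin using (Fin)
open import Data.Integer using (+_)
open import Data.Rational using (ℚ; _≤_; _<_; _+_; _*_; ½; 1ℚ; _/_)
open import Data.Product using (Σ; _×_; _,_)
open import Relation.Nullary using (¬_)

theorem11 : ((n : ℕ) (D : Fin n → ℕ) → Positive D →
               (Dens D + ½) * (Dens D + ½) ≤ (+ 2 / 1) → Schedulable D)
            × ((δ : ℚ) → 1ℚ < δ →
                 Σ ℕ λ n → Σ (Fin n → ℕ) λ D →
                   Positive D × (Dens D ≤ δ) × ¬ Schedulable D)
theorem11 = TwoVisits.lower-threshold , TwoVisits.upper-threshold
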